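{- Let $E=(d_1,\ldots,d_{m-1})$ be a valid ordered tuple, $d=d_1+\cdots+d_{m-1}$, $a_0<a_1<\cdots$ the terms of $S_E$, $z$ a positive integer, $R=\{a_0,\ldots,a_z\}$, $\max(R)=a_z$, $c=a_{z+1}$, and suppose: (i) $c=1+d\max(R)-\sum_{k=2}^{m-1}d_k(m-k-1)$; (ii) for every integer $0\le r_1\le c-1$ and every integer $0\le j\le d-2$, there exist $H_j\subseteq\{2,\ldots,m-1\}$ and $r_2,\ldots,r_m\in R$ with $\sum_{k\in H_j}d_k=j$, $\sum_{k=1}^{m-1}d_kr_k=dr_m$, the values $r_k$ ($k\in H_j\cup\{m\}$) pairwise distinct, and the values $r_k$ ($k\in\{2,\ldots,m-1\}\setminus H_j$) pairwise distinct. Let $\mathcal B_E$ be the set of all integers of the form $c\sum_{i\ge0}t_i(d+1)^i+r$ with $t_i\in\{0,1\}$ (finitely many nonzero) and $r\in R$. Then there are no distinct $x_1,\ldots,x_m\in\mathcal B_E$ with $d_1x_1+\cdots+d_{m-1}x_{m-1}=dx_m$.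
   Context: An ordered tuple $E=(d_1,\ldots,d_{m-1})$ of positive integers is written in nondecreasing order; $E$ is valid if $d_1=1$ and $d_l\le d_1+\cdots+d_{l-1}$ for every $2\le l\le m-1$. The sequence $S_E$ is defined greedily: $a_0=0$, and having chosen $a_0,\ldots,a_k$, $a_{k+1}$ is the least integer greater than $a_k$ such that there are no distinct $x_1,\ldots,x_m\in\{a_0,\ldots,a_{k+1}\}$ with $d_1x_1+\cdots+d_{m-1}x_{m-1}=dx_m$. -}

module Defs where

open import Data.Nat using (ℕ; zero; suc; _+_; _*_; _∸_; _≤_; _<_; _<?_)
open import Data.Fin using (Fin; toℕ) renaming (zero to fzero; suc to fsuc)
open import Data.Bool using (Bool; true; false; if_then_else_)
open import Data.List using (List; []; _∷_)
open import Data.Product using (∃; ∃-syntax; _×_; _,_)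
open import Data.Sum using (_⊎_)
open import Relation.Nullary using (¬_; does)
open import Relation.Binary.PropositionalEquality using (_≡_; _≢_)
open import Function.Definitions using (Injective)

-- Paper index k ∈ {1,…,m-1} corresponds to i : Fin n with toℕ i = k - 1,
-- where n = m - 1.  A tuple E = (d_1,…,d_{m-1}) is a function Fin n → ℕ.

∑ : ∀ {n} → (Fin n → ℕ) → ℕ
∑ {zero}  f = 0
∑ {suc n} f = f fzero + ∑ (λ i → f (fsuc i))

∑Below : ∀ {n} → ℕ → (Fin n → ℕ) → ℕ
∑Below l f = ∑ (λ i → if does (toℕ i <? l) then f i else 0)

dsum : ∀ {n} → (Fin n → ℕ) → ℕ
dsum d = ∑ d

lin : ∀ {n} → (Fin n → ℕ) → (Fin n → ℕ) → ℕ
lin d x = ∑ (λ i → d i * x i)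

record Valid {n : ℕ} (d : Fin n → ℕ) : Set where
  field
    nonempty : 1 ≤ n
    positive : ∀ i → 1 ≤ d i
    nondecr  : ∀ i j → toℕ i ≤ toℕ j → d i ≤ d j
    first    : ∀ i → toℕ i ≡ 0 → d i ≡ 1
    bounded  : ∀ l → 1 ≤ toℕ l → d l ≤ ∑Below (toℕ l) d

SolFree : ∀ {n} → (Fin n → ℕ) → (ℕ → Set) → Set
SolFree d P = ∀ (x : Fin _ → ℕ) (y : ℕ) → (∀ i → P (x i)) → P y →
  Injective _≡_ _≡_ x → (∀ i → x i ≢ y) → lin d x ≢ dsum d * y

Init : (ℕ → ℕ) → ℕ → ℕ → Set
Init a k v = ∃[ t ] (t ≤ k × v ≡ a t)

-- a is the greedy sequence S_E: a_0 = 0 and a_{k+1} is the least integer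
-- > a_k such that {a_0,…,a_{k+1}} is solution-free.
record IsSE {n : ℕ} (d : Fin n → ℕ) (a : ℕ → ℕ) : Set where
  field
    zero0   : a 0 ≡ 0
    incr    : ∀ k → a k < a (suc k)
    free    : ∀ k → SolFree d (Init a (suc k))
    least   : ∀ k y → a k < y → y < a (suc k) →
              ¬ SolFree d (λ v → Init a k v ⊎ v ≡ y)

digits : ℕ → List Bool → ℕ
digits b []       = 0
digits b (t ∷ ts) = (if t then 1 else 0) + b * digits b ts

InB : ℕ → ℕ → (ℕ → Set) → ℕ → Set
InB D c R x = ∃[ t ] ∃[ r ] (R r × x ≡ c * digits (suc D) t + r)

-- ∑_{k=2}^{m-1} d_k (m-k-1); with i = k-1, m = n+1: m-k-1 = n-1-i
corr : ∀ {n} → (Fin n → ℕ) → ℕ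
corr {n} d = ∑ (λ i → if does (0 <? toℕ i) then d i * (n ∸ 1 ∸ toℕ i) else 0)

inH : ∀ {n} → (Fin n → Bool) → Fin n → Set
inH H i = H i ≡ true

CondII : ∀ {n} → (Fin n → ℕ) → (ℕ → Set) → ℕ → Set
CondII {n} d R c =
  ∀ r1 j → r1 < c → j + 2 ≤ dsum d →
  ∃[ H ] ∃[ r ] ∃[ rm ]
    ( (∀ i → toℕ i ≡ 0 → H i ≡ false)
    × (∀ i → toℕ i ≡ 0 → r i ≡ r1)
    × (∀ i → 1 ≤ toℕ i → R (r i))
    × R rm
    × ∑ (λ i → if H i then d i else 0) ≡ j
    × lin d r ≡ dsum d * rm
    × (∀ i i' → inH H i → inH H i' → r i ≡ r i' → i ≡ i')
    × (∀ i → inH H i → r i ≢ rm)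
    × (∀ i i' → 1 ≤ toℕ i → 1 ≤ toℕ i' → H i ≡ false → H i' ≡ false →
         r i ≡ r i' → i ≡ i'))

module Submission where

-- Let n = m - 1 be the length of E, D = d_1 + ⋯ + d_{m-1}, c = a_{z+1} and
-- R = {a_0, …, a_z}.  Call (X, s, M) a *stage* when X is solution-free,
-- X ⊆ [0, M], s + corr d = 1 + D·M and n - 1 ≤ s.
--
-- The heart of the proof is the doubling lemma: if (X, s, M) is a stage, so
-- is (X ∪ (s + X), s(D+1), s + M).  Write the terms of a putative solution in
-- X ∪ (s + X) as x_k = ε_k s + u_k with ε_k ∈ {0,1} and u_k ∈ X.  If every
-- ε_k equals ε_m, the u_k form a solution in X.  Otherwise the equation is
-- unbalanced (after reflecting u ↦ M - u when ε_m = 1), which contradicts the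
-- weighted rearrangement inequality (indices k from 0)
--     ∑ d_k (n-1-k) ≤ ∑ d_k u_k + (∑_{ε_k = 1} d_k)(n-1),
-- valid when u is injective on each class of ε.  That inequality follows by
-- Abel summation (d is nondecreasing) from the triangular bound
-- 0 + 1 + ⋯ + (N-1) ≤ ∑ u for N distinct naturals u.

open import Defs
open import Data.Nat using (ℕ; suc; _+_; _*_; _≤_)
open import Data.Fin using (Fin)
open import Relation.Binary.PropositionalEquality using (_≡_)
open import Data.Nat using (zero; _∸_; _<_; _≤′_; ≤′-refl; ≤′-step; z≤n; s≤s; _≟_)
open import Data.Nat.Properties
open import Data.Nat.ListAction using (sum)
open import Data.Nat.Tactic.RingSolver using (solve-∀)
open import Algebra.Properties.CommutativeSemigroup +-commutativeSemigroup
  using () renaming (interchange to +-interchange; x∙yz≈y∙xz to +-left-comm)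
open import Data.Fin using (toℕ; fromℕ<) renaming (zero to fzero; suc to fsuc)
open import Data.Fin.Properties using (injective⇒≤; toℕ-fromℕ<)
  renaming (0≢1+n to fzero≢fsuc; suc-injective to fsuc-injective)
open import Data.Bool using (Bool; true; false; if_then_else_; not)
open import Data.Bool.Properties using (not-injective)
open import Data.List using (List; []; _∷_; length)
open import Data.List.Relation.Unary.All as All using (All; []; _∷_)
open import Data.List.Relation.Unary.AllPairs using ([]; _∷_)
open import Data.List.Relation.Unary.Unique.Propositional using (Unique)
open import Data.Product using (Σ; ∃-syntax; _×_; _,_; proj₁; proj₂)
open import Data.Sum using (_⊎_; inj₁; inj₂)
open import Data.Unit using (⊤; tt)
open import Data.Empty using (⊥; ⊥-elim)
open import Relation.Nullary using (yes; no)
open import Function using (_∘_)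
open import Relation.Binary.PropositionalEquality
  using (_≢_; refl; sym; trans; cong; cong₂; subst; subst₂; module ≡-Reasoning)

∑-cong : ∀ {n} {f g : Fin n → ℕ} → (∀ i → f i ≡ g i) → ∑ f ≡ ∑ g
∑-cong {zero}  f≡g = refl
∑-cong {suc n} f≡g = cong₂ _+_ (f≡g fzero) (∑-cong (λ i → f≡g (fsuc i)))

∑-+ : ∀ {n} (f g : Fin n → ℕ) → ∑ (λ i → f i + g i) ≡ ∑ f + ∑ g
∑-+ {zero}  f g = refl
∑-+ {suc n} f g =
  trans (cong (f fzero + g fzero +_) (∑-+ (λ i → f (fsuc i)) (λ i → g (fsuc i))))
        (+-interchange (f fzero) (g fzero) _ _)

∑-* : ∀ {n} (c : ℕ) (f : Fin n → ℕ) → ∑ (λ i → c * f i) ≡ c * ∑ f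
∑-* {zero}  c f = sym (*-zeroʳ c)
∑-* {suc n} c f =
  trans (cong (c * f fzero +_) (∑-* c (λ i → f (fsuc i)))) (sym (*-distribˡ-+ c (f fzero) _))

term≤∑ : ∀ {n} (f : Fin n → ℕ) (i : Fin n) → f i ≤ ∑ f
term≤∑ f fzero    = m≤m+n _ _
term≤∑ f (fsuc i) = ≤-trans (term≤∑ (λ j → f (fsuc j)) i) (m≤n+m _ _)

∑≡0⇒≡0 : ∀ {n} (f : Fin n → ℕ) → ∑ f ≡ 0 → ∀ i → f i ≡ 0
∑≡0⇒≡0 f ∑f≡0 fzero    = m+n≡0⇒m≡0 _ ∑f≡0
∑≡0⇒≡0 f ∑f≡0 (fsuc i) = ∑≡0⇒≡0 (λ j → f (fsuc j)) (m+n≡0⇒n≡0 (f fzero) ∑f≡0) i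

∑-const1 : ∀ {n} → ∑ {n} (λ _ → 1) ≡ n
∑-const1 {zero}  = refl
∑-const1 {suc n} = cong suc ∑-const1

triangle : ℕ → ℕ
triangle zero    = 0
triangle (suc k) = k + triangle k

-- the triangle numbers of a sum, needed to merge two classes of distinct values
triangle-+ : ∀ a b → triangle (a + b) ≡ triangle a + triangle b + a * b
triangle-+ zero    b = sym (+-identityʳ (triangle b))
triangle-+ (suc a) b rewrite triangle-+ a b = regroup a b (triangle a) (triangle b)
  where
  regroup : ∀ a b x y → a + b + (x + y + a * b) ≡ a + x + y + (b + a * b)
  regroup = solve-∀

delete : ℕ → List ℕ → List ℕ
delete N []       = []
delete N (x ∷ xs) with x ≟ N
... | yes _ = xs
... | no  _ = x ∷ delete N xs

delete-All : ∀ {P : ℕ → Set} N xs → All P xs → All P (delete N xs)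
delete-All N []       []         = []
delete-All N (x ∷ xs) (px ∷ pxs) with x ≟ N
... | yes _ = pxs
... | no  _ = px ∷ delete-All N xs pxs

delete-Unique : ∀ N xs → Unique xs → Unique (delete N xs)
delete-Unique N []       []           = []
delete-Unique N (x ∷ xs) (x∉xs ∷ uxs) with x ≟ N
... | yes _ = uxs
... | no  _ = delete-All N xs x∉xs ∷ delete-Unique N xs uxs

delete-below : ∀ N xs → Unique xs → All (_< suc N) xs → All (_< N) (delete N xs)
delete-below N []       []           []           = []
delete-below N (x ∷ xs) (x∉xs ∷ uxs) (x≤N ∷ xs≤N) with x ≟ N
... | yes refl = All.zipWith (λ (x≢y , y<sx) → ≤∧≢⇒< (≤-pred y<sx) (λ y≡x → x≢y (sym y≡x))) (x∉xs , xs≤N)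
... | no  x≢N  = ≤∧≢⇒< (≤-pred x≤N) x≢N ∷ delete-below N xs uxs xs≤N

delete-effect : ∀ N xs →
  (length xs ≡ length (delete N xs) × sum xs ≡ sum (delete N xs)) ⊎
  (length xs ≡ suc (length (delete N xs)) × sum xs ≡ N + sum (delete N xs))
delete-effect N []       = inj₁ (refl , refl)
delete-effect N (x ∷ xs) with x ≟ N
... | yes refl = inj₂ (refl , refl)
... | no  _ with delete-effect N xs
...   | inj₁ (len , tot) = inj₁ (cong suc len , cong (x +_) tot)
...   | inj₂ (len , tot) = inj₂ (cong suc len , trans (cong (x +_) tot) (+-left-comm x N _))

distinct-below : ∀ N xs → Unique xs → All (_< N) xs →
                 length xs ≤ N × triangle (length xs) ≤ sum xs
distinct-below zero    []       _ _          = z≤n , z≤n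
distinct-below zero    (x ∷ xs) _ (() ∷ _)
distinct-below (suc N) xs uxs xs<N
  with distinct-below N (delete N xs) (delete-Unique N xs uxs) (delete-below N xs uxs xs<N)
     | delete-effect N xs
... | len≤N , tri≤ | inj₁ (len , tot) rewrite len | tot = m≤n⇒m≤1+n len≤N , tri≤
... | len≤N , tri≤ | inj₂ (len , tot) rewrite len | tot = s≤s len≤N , +-mono-≤ len≤N tri≤

elements≤sum : ∀ xs → All (_≤ sum xs) xs
elements≤sum []       = []
elements≤sum (x ∷ xs) = m≤m+n x (sum xs) ∷ All.map (λ y≤ → ≤-trans y≤ (m≤n+m _ x)) (elements≤sum xs)

triangle≤sum : ∀ xs → Unique xs → triangle (length xs) ≤ sum xs
triangle≤sum xs uxs =
  proj₂ (distinct-below (suc (sum xs)) xs uxs (All.map s≤s (elements≤sum xs)))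

∑on : ∀ {n} → (Fin n → Bool) → (Fin n → ℕ) → ℕ
∑on g f = ∑ (λ i → if g i then f i else 0)

count : ∀ {n} → (Fin n → Bool) → ℕ
count g = ∑on g (λ _ → 1)

∑on-split : ∀ {n} (g : Fin n → Bool) (f : Fin n → ℕ) → ∑on g f + ∑on (not ∘ g) f ≡ ∑ f
∑on-split g f =
  trans (sym (∑-+ (λ i → if g i then f i else 0) (λ i → if not (g i) then f i else 0)))
        (∑-cong (λ i → split (g i) (f i)))
  where
  split : ∀ b x → (if b then x else 0) + (if not b then x else 0) ≡ x
  split true  x = +-identityʳ x
  split false x = refl

count-split : ∀ {n} (g : Fin n → Bool) → count g + count (not ∘ g) ≡ n
count-split g = trans (∑on-split g (λ _ → 1)) ∑-const1

∑on≡0⇒empty : ∀ {n} (g : Fin n → Bool) (f : Fin n → ℕ) → (∀ i → 1 ≤ f i) →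
              ∑on g f ≡ 0 → ∀ i → g i ≡ false
∑on≡0⇒empty g f pos ∑≡0 i with g i | ∑≡0⇒≡0 (λ i → if g i then f i else 0) ∑≡0 i
... | false | _   = refl
... | true  | f≡0 = ⊥-elim (<⇒≢ (pos i) (sym f≡0))

InjectiveOn : ∀ {n} → (Fin n → Bool) → (Fin n → ℕ) → Set
InjectiveOn g u = ∀ k l → g k ≡ true → g l ≡ true → u k ≡ u l → k ≡ l

valuesOn : ∀ {n} → (Fin n → Bool) → (Fin n → ℕ) → List ℕ
valuesOn {zero}  g u = []
valuesOn {suc n} g u with g fzero
... | true  = u fzero ∷ valuesOn (λ i → g (fsuc i)) (λ i → u (fsuc i))
... | false = valuesOn (λ i → g (fsuc i)) (λ i → u (fsuc i))

length-valuesOn : ∀ {n} (g : Fin n → Bool) u → length (valuesOn g u) ≡ count g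
length-valuesOn {zero}  g u = refl
length-valuesOn {suc n} g u with g fzero
... | true  = cong suc (length-valuesOn (λ i → g (fsuc i)) (λ i → u (fsuc i)))
... | false = length-valuesOn (λ i → g (fsuc i)) (λ i → u (fsuc i))

sum-valuesOn : ∀ {n} (g : Fin n → Bool) u → sum (valuesOn g u) ≡ ∑on g u
sum-valuesOn {zero}  g u = refl
sum-valuesOn {suc n} g u with g fzero
... | true  = cong (u fzero +_) (sum-valuesOn (λ i → g (fsuc i)) (λ i → u (fsuc i)))
... | false = sum-valuesOn (λ i → g (fsuc i)) (λ i → u (fsuc i))

valuesOn-avoid : ∀ {n} (g : Fin n → Bool) u v → (∀ i → g i ≡ true → u i ≢ v) →
                 All (_≢_ v) (valuesOn g u)
valuesOn-avoid {zero}  g u v avoid = []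
valuesOn-avoid {suc n} g u v avoid with g fzero in g0
... | true  = (λ v≡u → avoid fzero g0 (sym v≡u))
              ∷ valuesOn-avoid (λ i → g (fsuc i)) (λ i → u (fsuc i)) v (λ i → avoid (fsuc i))
... | false = valuesOn-avoid (λ i → g (fsuc i)) (λ i → u (fsuc i)) v (λ i → avoid (fsuc i))

valuesOn-Unique : ∀ {n} (g : Fin n → Bool) u → InjectiveOn g u → Unique (valuesOn g u)
valuesOn-Unique {zero}  g u inj = []
valuesOn-Unique {suc n} g u inj with g fzero in g0
... | true  = valuesOn-avoid _ _ (u fzero) (λ i gi u≡ → fzero≢fsuc (inj fzero (fsuc i) g0 gi (sym u≡)))
              ∷ valuesOn-Unique _ _ tailInj
  where
  tailInj : InjectiveOn (λ i → g (fsuc i)) (λ i → u (fsuc i))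
  tailInj k l gk gl u≡ = fsuc-injective (inj (fsuc k) (fsuc l) gk gl u≡)
... | false = valuesOn-Unique _ _ (λ k l gk gl u≡ → fsuc-injective (inj (fsuc k) (fsuc l) gk gl u≡))

triangle≤∑on : ∀ {n} (g : Fin n → Bool) u → InjectiveOn g u → triangle (count g) ≤ ∑on g u
triangle≤∑on g u inj =
  subst₂ (λ k t → triangle k ≤ t) (length-valuesOn g u) (sum-valuesOn g u)
         (triangle≤sum (valuesOn g u) (valuesOn-Unique g u inj))

ClassInjective : ∀ {n} → (Fin n → Bool) → (Fin n → ℕ) → Set
ClassInjective g u = ∀ k l → g k ≡ g l → u k ≡ u l → k ≡ l

-- if a + b = n and a ≠ 0 then b ≤ n - 1
cross-term : ∀ a b → a * b ≤ a * (a + b ∸ 1)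
cross-term zero    b = z≤n
cross-term (suc a) b = *-monoʳ-≤ (suc a) (m≤n+m b a)

-- n values forming two classes of distinct values: the triangular bound
-- holds up to the loss count g · (n - 1) caused by repetitions across classes
two-class-bound : ∀ {n} (g : Fin n → Bool) u → ClassInjective g u →
                  triangle n ≤ ∑ u + count g * (n ∸ 1)
two-class-bound {n} g u inj = begin
  triangle n                             ≡⟨ cong triangle (sym (count-split g)) ⟩
  triangle (a + b)                       ≡⟨ triangle-+ a b ⟩
  triangle a + triangle b + a * b        ≤⟨ +-mono-≤ (+-mono-≤ inClass inComplement) cross ⟩
  ∑on g u + ∑on ḡ u + a * (n ∸ 1)        ≡⟨ cong (_+ a * (n ∸ 1)) (∑on-split g u) ⟩
  ∑ u + a * (n ∸ 1)                      ∎
  where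
  open ≤-Reasoning
  ḡ : Fin n → Bool
  ḡ = not ∘ g
  a = count g
  b = count ḡ
  inClass : triangle a ≤ ∑on g u
  inClass = triangle≤∑on g u (λ k l gk gl → inj k l (trans gk (sym gl)))
  inComplement : triangle b ≤ ∑on ḡ u
  inComplement = triangle≤∑on ḡ u (λ k l gk gl → inj k l (not-injective (trans gk (sym gl))))
  cross : a * b ≤ a * (n ∸ 1)
  cross = subst (λ k → a * b ≤ a * (k ∸ 1)) (count-split g) (cross-term a b)

SuffixDominated : ∀ {n} → (Fin n → ℕ) → (Fin n → ℕ) → Set
SuffixDominated {zero}  w v = ⊤
SuffixDominated {suc n} w v =
  ∑ w ≤ ∑ v × SuffixDominated (λ i → w (fsuc i)) (λ i → v (fsuc i))

Nondecreasing : ∀ {n} → (Fin n → ℕ) → Set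
Nondecreasing d = ∀ i j → toℕ i ≤ toℕ j → d i ≤ d j

lin-peel : ∀ {n} (d w : Fin (suc n) → ℕ) → (∀ i → d fzero ≤ d i) →
           lin d w ≡ d fzero * ∑ w + lin (λ i → d (fsuc i) ∸ d fzero) (λ i → w (fsuc i))
lin-peel d w d₀≤ = begin
  d₀ * w₀ + lin (λ i → d (fsuc i)) w'   ≡⟨ cong (d₀ * w₀ +_) tail-split ⟩
  d₀ * w₀ + (d₀ * ∑ w' + lin d' w')     ≡⟨ sym (+-assoc (d₀ * w₀) _ _) ⟩
  d₀ * w₀ + d₀ * ∑ w' + lin d' w'       ≡⟨ cong (_+ lin d' w') (sym (*-distribˡ-+ d₀ w₀ _)) ⟩
  d₀ * ∑ w + lin d' w'                  ∎
  where
  open ≡-Reasoning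
  d₀ = d fzero
  w₀ = w fzero
  w' : Fin _ → ℕ
  w' i = w (fsuc i)
  d' : Fin _ → ℕ
  d' i = d (fsuc i) ∸ d₀
  split : ∀ i → d (fsuc i) * w' i ≡ d₀ * w' i + d' i * w' i
  split i = trans (cong (_* w' i) (sym (m+[n∸m]≡n (d₀≤ (fsuc i))))) (*-distribʳ-+ (w' i) d₀ (d' i))
  tail-split : lin (λ i → d (fsuc i)) w' ≡ d₀ * ∑ w' + lin d' w'
  tail-split = trans (∑-cong split)
                     (trans (∑-+ (λ i → d₀ * w' i) (λ i → d' i * w' i)) (cong (_+ lin d' w') (∑-* d₀ w')))

-- Abel summation: nondecreasing weights preserve suffix domination
abel : ∀ {n} (d : Fin n → ℕ) → Nondecreasing d → ∀ w v → SuffixDominated w v → lin d w ≤ lin d v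
abel {zero}  d mono w v _                 = z≤n
abel {suc n} d mono w v (∑w≤∑v , suffixes) = begin
  lin d w                                       ≡⟨ lin-peel d w d₀≤ ⟩
  d fzero * ∑ w + lin d' (λ i → w (fsuc i))     ≤⟨ +-mono-≤ (*-monoʳ-≤ (d fzero) ∑w≤∑v)
                                                             (abel d' mono' _ _ suffixes) ⟩
  d fzero * ∑ v + lin d' (λ i → v (fsuc i))     ≡⟨ sym (lin-peel d v d₀≤) ⟩
  lin d v                                       ∎
  where
  open ≤-Reasoning
  d₀≤ : ∀ i → d fzero ≤ d i
  d₀≤ i = mono fzero i z≤n
  d' : Fin n → ℕ
  d' i = d (fsuc i) ∸ d fzero
  mono' : Nondecreasing d'
  mono' i j i≤j = ∸-monoˡ-≤ (d fzero) (mono (fsuc i) (fsuc j) (s≤s i≤j))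

staircase : ∀ n → Fin n → ℕ
staircase (suc n) fzero    = n
staircase (suc n) (fsuc i) = staircase n i

staircase-toℕ : ∀ n (i : Fin n) → staircase n i ≡ n ∸ suc (toℕ i)
staircase-toℕ (suc n) fzero    = refl
staircase-toℕ (suc n) (fsuc i) = staircase-toℕ n i

∑-staircase : ∀ n → ∑ (staircase n) ≡ triangle n
∑-staircase zero    = refl
∑-staircase (suc n) = cong (n +_) (∑-staircase n)

select-const : ∀ b K → (if b then K else 0) ≡ K * (if b then 1 else 0)
select-const true  K = sym (*-identityʳ K)
select-const false K = sym (*-zeroʳ K)

select-* : ∀ b x K → x * (if b then K else 0) ≡ K * (if b then x else 0)
select-* true  x K = *-comm x K
select-* false x K = trans (*-zeroʳ x) (sym (*-zeroʳ K))

staircase-dominated : ∀ {n} (g : Fin n → Bool) u → ClassInjective g u → ∀ K → n ∸ 1 ≤ K →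
                      SuffixDominated (staircase n) (λ i → u i + (if g i then K else 0))
staircase-dominated {zero}  g u inj K n≤K = tt
staircase-dominated {suc n} g u inj K n≤K = head , tail
  where
  open ≤-Reasoning
  penalty : ∑ (λ i → if g i then K else 0) ≡ count g * K
  penalty = trans (∑-cong (λ i → select-const (g i) K))
                  (trans (∑-* K (λ i → if g i then 1 else 0)) (*-comm K (count g)))
  head : ∑ (staircase (suc n)) ≤ ∑ (λ i → u i + (if g i then K else 0))
  head = begin
    ∑ (staircase (suc n))                    ≡⟨ ∑-staircase (suc n) ⟩
    triangle (suc n)                         ≤⟨ two-class-bound g u inj ⟩
    ∑ u + count g * n                        ≤⟨ +-monoʳ-≤ (∑ u) (*-monoʳ-≤ (count g) n≤K) ⟩
    ∑ u + count g * K                        ≡⟨ cong (∑ u +_) (sym penalty) ⟩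
    ∑ u + ∑ (λ i → if g i then K else 0)     ≡⟨ sym (∑-+ u (λ i → if g i then K else 0)) ⟩
    ∑ (λ i → u i + (if g i then K else 0))   ∎
  tail : SuffixDominated (staircase n) (λ i → u (fsuc i) + (if g (fsuc i) then K else 0))
  tail = staircase-dominated (λ i → g (fsuc i)) (λ i → u (fsuc i))
           (λ k l gk u≡ → fsuc-injective (inj (fsuc k) (fsuc l) gk u≡)) K (≤-trans (m∸n≤m n 1) n≤K)

rearrangement : ∀ {n} (d : Fin n → ℕ) → Nondecreasing d → ∀ g u → ClassInjective g u →
                lin d (staircase n) ≤ lin d u + ∑on g d * (n ∸ 1)
rearrangement {n} d mono g u inj = begin
  lin d (staircase n)                   ≤⟨ abel d mono _ _ (staircase-dominated g u inj p ≤-refl) ⟩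
  lin d (λ i → u i + penalty i)         ≡⟨ ∑-cong distribute ⟩
  ∑ (λ i → d i * u i + p * dg i)        ≡⟨ ∑-+ (λ i → d i * u i) (λ i → p * dg i) ⟩
  lin d u + ∑ (λ i → p * dg i)          ≡⟨ cong (lin d u +_) (trans (∑-* p dg) (*-comm p (∑on g d))) ⟩
  lin d u + ∑on g d * p                 ∎
  where
  open ≤-Reasoning
  p = n ∸ 1
  penalty : Fin n → ℕ
  penalty i = if g i then p else 0
  dg : Fin n → ℕ
  dg i = if g i then d i else 0
  distribute : ∀ i → d i * (u i + penalty i) ≡ d i * u i + p * dg i
  distribute i = trans (*-distribˡ-+ (d i) (u i) _) (cong (d i * u i +_) (select-* (g i) (d i) p))

staircase-corr : ∀ {n} (d : Fin n → ℕ) → Valid d → lin d (staircase n) ≡ corr d + (n ∸ 1)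
staircase-corr {zero}  d V with Valid.nonempty V
... | ()
staircase-corr {suc m} d V rewrite Valid.first V fzero refl = begin
  1 * m + lin (λ i → d (fsuc i)) (staircase m)            ≡⟨ cong₂ _+_ (*-identityˡ m)
                                                               (∑-cong (λ i → cong (d (fsuc i) *_) (staircase-toℕ m i))) ⟩
  m + ∑ (λ i → d (fsuc i) * (m ∸ suc (toℕ i)))            ≡⟨ +-comm m _ ⟩
  ∑ (λ i → d (fsuc i) * (m ∸ suc (toℕ i))) + m            ∎
  where open ≡-Reasoning

no-room : ∀ s W L p → 1 ≤ W → p ≤ s → s * W + L + 1 + p ≤ s + L + W * p → ⊥
no-room s (suc w) L p _ p≤s fits = <-irrefl refl (begin-strict
  s * w       <⟨ +-cancelˡ-≤ (s + L + p) _ _ (subst₂ _≤_ (lhs s w L p) (rhs s w L p) fits) ⟩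
  w * p       ≤⟨ *-monoʳ-≤ w p≤s ⟩
  w * s       ≡⟨ *-comm w s ⟩
  s * w       ∎)
  where
  open ≤-Reasoning
  lhs : ∀ s w L p → s * suc w + L + 1 + p ≡ (s + L + p) + suc (s * w)
  lhs = solve-∀
  rhs : ∀ s w L p → s + L + suc w * p ≡ (s + L + p) + w * p
  rhs = solve-∀

-- X ∪ (s + X): one more binary digit of weight s
Doubled : (ℕ → Set) → ℕ → ℕ → Set
Doubled X s v = X v ⊎ ∃[ u ] (X u × v ≡ s + u)

shiftBy : ℕ → Bool → ℕ
shiftBy s b = if b then s else 0

decompose : ∀ {X s v} → Doubled X s v → Σ Bool λ ε → Σ ℕ λ u → X u × v ≡ shiftBy s ε + u
decompose {v = v} (inj₁ Xv)            = false , v , Xv , refl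
decompose         (inj₂ (u , Xu , v≡)) = true , u , Xu , v≡

SolFree-mono : ∀ {n} (d : Fin n → ℕ) {P Q : ℕ → Set} → (∀ v → P v → Q v) → SolFree d Q → SolFree d P
SolFree-mono d P⊆Q freeQ x y Px Py = freeQ x y (λ i → P⊆Q _ (Px i)) (P⊆Q _ Py)

module _ {n} (d : Fin n → ℕ) where

  lin-shifted : ∀ s (x u : Fin n → ℕ) ε → (∀ k → x k ≡ shiftBy s (ε k) + u k) →
                lin d x ≡ s * ∑on ε d + lin d u
  lin-shifted s x u ε x≡ = begin
    lin d x                                ≡⟨ ∑-cong distribute ⟩
    ∑ (λ k → s * dε k + d k * u k)         ≡⟨ ∑-+ (λ k → s * dε k) (λ k → d k * u k) ⟩
    ∑ (λ k → s * dε k) + lin d u           ≡⟨ cong (_+ lin d u) (∑-* s dε) ⟩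
    s * ∑on ε d + lin d u                  ∎
    where
    open ≡-Reasoning
    dε : Fin n → ℕ
    dε k = if ε k then d k else 0
    distribute : ∀ k → d k * x k ≡ s * dε k + d k * u k
    distribute k = trans (cong (d k *_) (x≡ k))
                   (trans (*-distribˡ-+ (d k) (shiftBy s (ε k)) (u k))
                          (cong (_+ d k * u k) (select-* (ε k) (d k) s)))

  reflect : ∀ M (u : Fin n → ℕ) y t → (∀ k → u k ≤ M) → lin d u ≡ t + dsum d * y →
            dsum d * (M ∸ y) ≡ t + lin d (λ k → M ∸ u k)
  reflect M u y t u≤M lin≡ = begin
    dsum d * (M ∸ y)                   ≡⟨ *-distribˡ-∸ (dsum d) M y ⟩
    dsum d * M ∸ dsum d * y            ≡⟨ cong (_∸ dsum d * y) (sym complementary) ⟩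
    lin d u + lin d v ∸ dsum d * y     ≡⟨ cong (λ l → l + lin d v ∸ dsum d * y) lin≡ ⟩
    t + dsum d * y + lin d v ∸ dsum d * y ≡⟨ cong (_∸ dsum d * y) (swap t (dsum d * y) (lin d v)) ⟩
    t + lin d v + dsum d * y ∸ dsum d * y ≡⟨ m+n∸n≡m (t + lin d v) (dsum d * y) ⟩
    t + lin d v                        ∎
    where
    open ≡-Reasoning
    v : Fin n → ℕ
    v k = M ∸ u k
    swap : ∀ a b c → a + b + c ≡ a + c + b
    swap = solve-∀
    complementary : lin d u + lin d v ≡ dsum d * M
    complementary = trans (sym (∑-+ (λ k → d k * u k) (λ k → d k * v k)))
      (trans (∑-cong (λ k → trans (sym (*-distribˡ-+ (d k) (u k) (v k)))
                              (trans (cong (d k *_) (m+[n∸m]≡n (u≤M k))) (*-comm (d k) M))))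
             (trans (∑-* M d) (*-comm M (dsum d))))

  -- with the target shifted by s, the unshifted parts exceed D·u_y by s times
  -- the weight of the complementary class, since ∑_ε d + ∑_{not ε} d = D
  shifted-excess : ∀ s ε (u : Fin n → ℕ) uy → s * ∑on ε d + lin d u ≡ dsum d * (s + uy) →
                   lin d u ≡ s * ∑on (not ∘ ε) d + dsum d * uy
  shifted-excess s ε u uy eq = +-cancelˡ-≡ (s * ∑on ε d) _ _ (begin
    s * ∑on ε d + lin d u                            ≡⟨ eq ⟩
    dsum d * (s + uy)                                ≡⟨ *-distribˡ-+ (dsum d) s uy ⟩
    dsum d * s + dsum d * uy                         ≡⟨ cong (_+ dsum d * uy) (*-comm (dsum d) s) ⟩
    s * dsum d + dsum d * uy                         ≡⟨ cong (λ w → s * w + dsum d * uy) (sym (∑on-split ε d)) ⟩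
    s * (∑on ε d + ∑on (not ∘ ε) d) + dsum d * uy    ≡⟨ cong (_+ dsum d * uy) (*-distribˡ-+ s (∑on ε d) _) ⟩
    s * ∑on ε d + s * ∑on (not ∘ ε) d + dsum d * uy  ≡⟨ +-assoc (s * ∑on ε d) _ _ ⟩
    s * ∑on ε d + (s * ∑on (not ∘ ε) d + dsum d * uy) ∎)
    where open ≡-Reasoning

module _ {n} (d : Fin n → ℕ) (V : Valid d) where

  unbalanced : ∀ s M → s + corr d ≡ 1 + dsum d * M → n ∸ 1 ≤ s →
               ∀ (g : Fin n → Bool) u y → ClassInjective g u → y ≤ M → 1 ≤ ∑on g d →
               dsum d * y ≢ s * ∑on g d + lin d u
  unbalanced s M offset large g u y inj y≤M 1≤W eq = no-room s W L p 1≤W large (begin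
    s * W + L + 1 + p        ≤⟨ +-monoˡ-≤ p (+-monoˡ-≤ 1 (subst (_≤ dsum d * M) eq (*-monoʳ-≤ (dsum d) y≤M))) ⟩
    dsum d * M + 1 + p       ≡⟨ cong (_+ p) (trans (+-comm _ 1) (sym offset)) ⟩
    s + corr d + p           ≡⟨ +-assoc s (corr d) p ⟩
    s + (corr d + p)         ≡⟨ cong (s +_) (sym (staircase-corr d V)) ⟩
    s + lin d (staircase n)  ≤⟨ +-monoʳ-≤ s (rearrangement d (Valid.nondecr V) g u inj) ⟩
    s + (L + W * p)          ≡⟨ sym (+-assoc s L _) ⟩
    s + L + W * p            ∎)
    where
    open ≤-Reasoning
    W = ∑on g d
    L = lin d u
    p = n ∸ 1

  record Stage (X : ℕ → Set) (s M : ℕ) : Set where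
    field
      solutionFree : SolFree d X
      bounded      : ∀ v → X v → v ≤ M
      offset       : s + corr d ≡ 1 + dsum d * M
      large        : n ∸ 1 ≤ s

  module Doubling {X : ℕ → Set} {s M : ℕ} (stage : Stage X s M) where
    open Stage stage

    -- all terms shifted alike as the target: the unshifted parts solve the equation in X
    homogeneous : ∀ (ε : Fin n → Bool) u b uy → (∀ k → X (u k)) → X uy → ClassInjective ε u →
                  (∀ k → ε k ≡ b → u k ≢ uy) → (∀ k → ε k ≡ b) → lin d u ≢ dsum d * uy
    homogeneous ε u b uy Xu Xuy inj apart same =
      solutionFree u uy Xu Xuy (λ {k} {l} → inj k l (trans (same k) (sym (same l)))) (λ k → apart k (same k))

    lowTarget : ∀ ε u uy → (∀ k → X (u k)) → X uy → ClassInjective ε u →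
                (∀ k → ε k ≡ false → u k ≢ uy) → s * ∑on ε d + lin d u ≢ dsum d * uy
    lowTarget ε u uy Xu Xuy inj apart eq with ∑on ε d ≟ 0
    ... | yes W≡0 = homogeneous ε u false uy Xu Xuy inj apart (∑on≡0⇒empty ε d (Valid.positive V) W≡0)
                      (trans (cong (λ w → w + lin d u) (sym (trans (cong (s *_) W≡0) (*-zeroʳ s)))) eq)
    ... | no  W≢0 = unbalanced s M offset large ε u uy inj (bounded uy Xuy) (n≢0⇒n>0 W≢0) (sym eq)

    -- the target is shifted by s: argue with the complementary class, reflected in M
    highTarget : ∀ ε u uy → (∀ k → X (u k)) → X uy → ClassInjective ε u →
                 (∀ k → ε k ≡ true → u k ≢ uy) → s * ∑on ε d + lin d u ≢ dsum d * (s + uy)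
    highTarget ε u uy Xu Xuy inj apart eq with ∑on (not ∘ ε) d ≟ 0
    ... | yes W̄≡0 = homogeneous ε u true uy Xu Xuy inj apart
                      (λ k → not-injective (∑on≡0⇒empty (not ∘ ε) d (Valid.positive V) W̄≡0 k))
                      (trans (shifted-excess d s ε u uy eq)
                             (cong (λ w → w + dsum d * uy) (trans (cong (s *_) W̄≡0) (*-zeroʳ s))))
    ... | no  W̄≢0 = unbalanced s M offset large (not ∘ ε) (λ k → M ∸ u k) (M ∸ uy) reflectedInj
                      (m∸n≤m M uy) (n≢0⇒n>0 W̄≢0)
                      (reflect d M u uy (s * ∑on (not ∘ ε) d) (λ k → bounded (u k) (Xu k))
                               (shifted-excess d s ε u uy eq))
      where
      cancel : ∀ {a b} → a ≤ M → b ≤ M → M ∸ a ≡ M ∸ b → a ≡ b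
      cancel a≤M b≤M M∸a≡M∸b = trans (sym (m∸[m∸n]≡n a≤M)) (trans (cong (M ∸_) M∸a≡M∸b) (m∸[m∸n]≡n b≤M))
      reflectedInj : ClassInjective (not ∘ ε) (λ k → M ∸ u k)
      reflectedInj k l ε̄≡ v≡ =
        inj k l (not-injective ε̄≡) (cancel (bounded (u k) (Xu k)) (bounded (u l) (Xu l)) v≡)

    shiftedSolution : ∀ ε u εy uy → (∀ k → X (u k)) → X uy → ClassInjective ε u →
                      (∀ k → ε k ≡ εy → u k ≢ uy) →
                      s * ∑on ε d + lin d u ≢ dsum d * (shiftBy s εy + uy)
    shiftedSolution ε u false uy = lowTarget ε u uy
    shiftedSolution ε u true  uy = highTarget ε u uy

    doubled-free : SolFree d (Doubled X s)
    doubled-free x y Dx Dy injx x≢y lin≡ =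
      shiftedSolution ε u εy uy Xu Xuy inj apart
        (trans (sym (lin-shifted d s x u ε x≡)) (trans lin≡ (cong (dsum d *_) y≡)))
      where
      ε : Fin n → Bool
      ε k = proj₁ (decompose (Dx k))
      u : Fin n → ℕ
      u k = proj₁ (proj₂ (decompose (Dx k)))
      Xu : ∀ k → X (u k)
      Xu k = proj₁ (proj₂ (proj₂ (decompose (Dx k))))
      x≡ : ∀ k → x k ≡ shiftBy s (ε k) + u k
      x≡ k = proj₂ (proj₂ (proj₂ (decompose (Dx k))))
      εy = proj₁ (decompose Dy)
      uy = proj₁ (proj₂ (decompose Dy))
      Xuy = proj₁ (proj₂ (proj₂ (decompose Dy)))
      y≡ : y ≡ shiftBy s εy + uy
      y≡ = proj₂ (proj₂ (proj₂ (decompose Dy)))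
      same : ∀ {b b' t t'} → b ≡ b' → t ≡ t' → shiftBy s b + t ≡ shiftBy s b' + t'
      same = cong₂ (λ b t → shiftBy s b + t)
      inj : ClassInjective ε u
      inj k l ε≡ u≡ = injx (trans (x≡ k) (trans (same ε≡ u≡) (sym (x≡ l))))
      apart : ∀ k → ε k ≡ εy → u k ≢ uy
      apart k ε≡ u≡ = x≢y k (trans (x≡ k) (trans (same ε≡ u≡) (sym y≡)))

  double : ∀ {X s M} → Stage X s M → Stage (Doubled X s) (s * suc (dsum d)) (s + M)
  double {X} {s} {M} stage = record
    { solutionFree = Doubling.doubled-free stage
    ; bounded      = bounded′
    ; offset       = trans (regroup s (dsum d) (corr d)) (trans (cong (_+ s * dsum d) offset)
                                                                (expand (dsum d) M s))
    ; large        = ≤-trans large (m≤m*n s (suc (dsum d)))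
    }
    where
    open Stage stage
    bounded′ : ∀ v → Doubled X s v → v ≤ s + M
    bounded′ v (inj₁ Xv)                = ≤-trans (bounded v Xv) (m≤n+m M s)
    bounded′ v (inj₂ (u , Xu , refl))   = +-monoʳ-≤ s (bounded u Xu)
    regroup : ∀ s D c → s * suc D + c ≡ s + c + s * D
    regroup = solve-∀
    expand : ∀ D M s → 1 + D * M + s * D ≡ 1 + D * (s + M)
    expand = solve-∀

  Expansions : ℕ → (ℕ → Set) → ℕ → ℕ → Set
  Expansions L X s v = ∃[ t ] (length t ≤ L × ∃[ u ] (X u × v ≡ s * digits (suc (dsum d)) t + u))

  expansions-zero : ∀ {X s v} → Expansions 0 X s v → X v
  expansions-zero {X} {s} ([] , _ , u , Xu , v≡) = subst X (sym (trans v≡ (cong (_+ u) (*-zeroʳ s)))) Xu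

  -- the lowest digit is absorbed by doubling: s(t₀ + (D+1)t') + u = s(D+1)t' + (t₀ s + u)
  expansions-shift : ∀ {L X s v} → Expansions (suc L) X s v →
                     Expansions L (Doubled X s) (s * suc (dsum d)) v
  expansions-shift {s = s} ([] , _ , u , Xu , v≡) =
    [] , z≤n , u , inj₁ Xu , trans v≡ (cong (_+ u) (trans (*-zeroʳ s) (sym (*-zeroʳ (s * suc (dsum d))))))
  expansions-shift {s = s} ((false ∷ t) , s≤s len , u , Xu , v≡) =
    t , len , u , inj₁ Xu , trans v≡ (cong (_+ u) (sym (*-assoc s (suc (dsum d)) _)))
  expansions-shift {s = s} ((true ∷ t) , s≤s len , u , Xu , v≡) =
    t , len , s + u , inj₂ (u , Xu , refl) , trans v≡ (lowDigit s (suc (dsum d)) (digits (suc (dsum d)) t) u)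
    where
    lowDigit : ∀ s B t u → s * (1 + B * t) + u ≡ s * B * t + (s + u)
    lowDigit = solve-∀

  -- L doublings: the expansions with at most L digits form a solution-free set
  expansions-free : ∀ L {X s M} → Stage X s M → SolFree d (Expansions L X s)
  expansions-free zero    {s = s} stage =
    SolFree-mono d (λ _ → expansions-zero {s = s}) (Stage.solutionFree stage)
  expansions-free (suc L) {s = s} stage =
    SolFree-mono d (λ _ → expansions-shift {s = s}) (expansions-free L (double stage))

  -- a solution only involves finitely many digits
  InB-free : ∀ {X s M} → Stage X s M → SolFree d (InB (dsum d) s X)
  InB-free {X} {s} stage x y Bx By =
    expansions-free L stage x y (λ k → bounded-expansion (Bx k) (ofTerm k)) (bounded-expansion By ofTarget)
    where
    L = ∑ (λ k → length (proj₁ (Bx k))) + length (proj₁ By)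
    ofTerm : ∀ k → length (proj₁ (Bx k)) ≤ L
    ofTerm k = ≤-trans (term≤∑ (λ k → length (proj₁ (Bx k))) k) (m≤m+n _ _)
    ofTarget : length (proj₁ By) ≤ L
    ofTarget = m≤n+m _ _
    bounded-expansion : ∀ {v} (Bv : InB (dsum d) s X v) → length (proj₁ Bv) ≤ L → Expansions L X s v
    bounded-expansion (t , u , Xu , v≡) len = t , len , u , Xu , v≡

-- Condition (ii) with r_1 = 0 and j = 0 yields n - 1 distinct elements of R,
-- so n - 1 ≤ N whenever R ⊆ [0, N)
condII-large : ∀ {n} (d : Fin n → ℕ) → Valid d → ∀ R c N → CondII d R c → 0 < c →
               (∀ v → R v → v < N) → n ∸ 1 ≤ N
condII-large {zero}        d V R c N cii 0<c R<N = z≤n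
condII-large {suc zero}    d V R c N cii 0<c R<N = z≤n
condII-large {suc (suc m)} d V R c N cii 0<c R<N with cii 0 0 0<c twoTerms
  where
  twoTerms : 2 ≤ dsum d
  twoTerms = +-mono-≤ (Valid.positive V fzero) (≤-trans (Valid.positive V (fsuc fzero)) (m≤m+n _ _))
... | H , r , _ , _ , _ , inR , _ , H-weight , _ , _ , _ , injOutsideH = injective⇒≤ indexInjective
  where
  Hempty : ∀ i → H i ≡ false
  Hempty = ∑on≡0⇒empty H d (Valid.positive V) H-weight
  index : Fin (suc m) → Fin N
  index i = fromℕ< (R<N _ (inR (fsuc i) (s≤s z≤n)))
  indexInjective : ∀ {i j} → index i ≡ index j → i ≡ j
  indexInjective {i} {j} index≡ = fsuc-injective
    (injOutsideH (fsuc i) (fsuc j) (s≤s z≤n) (s≤s z≤n) (Hempty _) (Hempty _)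
                 (trans (sym (toℕ-fromℕ< _)) (trans (cong toℕ index≡) (toℕ-fromℕ< _))))

increasing⇒monotone : ∀ (a : ℕ → ℕ) → (∀ k → a k < a (suc k)) → ∀ {i j} → i ≤′ j → a i ≤ a j
increasing⇒monotone a inc ≤′-refl         = ≤-refl
increasing⇒monotone a inc (≤′-step i≤′j) = ≤-trans (increasing⇒monotone a inc i≤′j) (<⇒≤ (inc _))

-- Lemma 3: (R, c, a_z) is a stage, by the greedy construction of S_E (R is
-- solution-free and increasing), hypothesis (i) and condition (ii); hence 𝓑_E
-- is solution-free
lemma3 : ∀ {n : ℕ} (d : Fin n → ℕ) → Valid d →
         ∀ (a : ℕ → ℕ) → IsSE d a →
         ∀ (z : ℕ) → 1 ≤ z →
         a (suc z) + corr d ≡ 1 + dsum d * a z →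
         CondII d (Init a z) (a (suc z)) →
         SolFree d (InB (dsum d) (a (suc z)) (Init a z))
lemma3 d V a se (suc z) _ offset cii = InB-free d V initial
  where
  R≤a_z : ∀ v → Init a (suc z) v → v ≤ a (suc z)
  R≤a_z v (t , t≤z , refl) = increasing⇒monotone a (IsSE.incr se) (≤⇒≤′ t≤z)
  0<c : 0 < a (suc (suc z))
  0<c = ≤-trans (s≤s z≤n) (IsSE.incr se (suc z))
  initial : Stage d V (Init a (suc z)) (a (suc (suc z))) (a (suc z))
  initial = record
    { solutionFree = IsSE.free se z
    ; bounded      = R≤a_z
    ; offset       = offset
    ; large        = ≤-trans (condII-large d V _ _ (suc (a (suc z))) cii 0<c (λ v Rv → s≤s (R≤a_z v Rv)))
                             (IsSE.incr se (suc z))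
    }
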